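{- Let $G$ be a co-graph. Then $G$ is module-composed if and only if $G$ does not contain co-$2C_4$ as an induced subgraph.
   Context: All graphs are finite, simple and undirected. For a graph $G=(V_G,E_G)$ and $v\in V_G$, $N(v)=\{w\in V_G : \{v,w\}\in E_G\}$. A set $M\subseteq V_G$ is a module of $G$ if for all $v_1,v_2\in M$ we have $N(v_1)\setminus M=N(v_2)\setminus M$ (in particular the empty set, singletons and $V_G$ are modules). For $U\subseteq V_G$, $G[U]$ is the induced subgraph on $U$. A graph $G$ is module-composed if there is a bijection $\varphi:V_G\to\{1,\ldots,|V_G|\}$ such that for every $2\le i\le |V_G|$ the neighbourhood of $\varphi^{ -1}(i)$ in the graph $G[\{\varphi^{ -1}(1),\ldots,\varphi^{ -1}(i-1)\}]$ is a module of that graph. A co-graph is a graph obtainable from single vertices by repeatedly taking disjoint unions of two co-graphs and joins of two co-graphs (the join adds all edges between the two vertex sets). The graph co-$2C_4$ is the complement of the disjoint union of two 4-cycles. -}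

module Defs where

open import Data.Nat using (ℕ; zero; suc; _+_; _≡ᵇ_; _/_; _%_)
open import Data.Bool using (Bool; true; false; not; _∧_; _∨_)
open import Data.Fin using (Fin; toℕ; splitAt; _<_)
open import Data.Sum using (_⊎_; inj₁; inj₂)
open import Data.Product using (Σ; _×_)
open import Relation.Binary.PropositionalEquality using (_≡_)
open import Function.Bundles using (_↔_; Inverse)
open import Function.Definitions using (Injective)

record Graph : Set where
  field
    n   : ℕ
    adj : Fin n → Fin n → Bool
open Graph public

IsSimple : Graph → Set
IsSimple G = (∀ x y → adj G x y ≡ adj G y x) × (∀ x → adj G x x ≡ false)

record _≅_ (G H : Graph) : Set where
  field
    bij      : Fin (n G) ↔ Fin (n H)
    preserve : ∀ x y → adj H (Inverse.to bij x) (Inverse.to bij y) ≡ adj G x y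

VSet : Graph → Set₁
VSet G = Fin (n G) → Set

IsModuleOf : (G : Graph) → VSet G → VSet G → Set
IsModuleOf G U M =
  (∀ v → M v → U v) ×
  (∀ v₁ v₂ w → M v₁ → M v₂ → U w → (M w → Data.Empty.⊥) → adj G v₁ w ≡ adj G v₂ w)
  where import Data.Empty

-- Module-composed: there is a bijection φ : V → {1..|V|} (we use its inverse σ,
-- 0-based) such that for each i ≥ 1 (i.e. 2 ≤ i+1), the neighbourhood of σ i in
-- G[{σ j | j < i}] is a module of G[{σ j | j < i}].
ModuleComposed : Graph → Set
ModuleComposed G =
  Σ (Fin (n G) ↔ Fin (n G)) λ φ →
    let σ = Inverse.from φ
        Prefix : Fin (n G) → VSet G
        Prefix i v = Σ (Fin (n G)) λ j → (j < i) × (σ j ≡ v)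
        Nbh : Fin (n G) → VSet G
        Nbh i v = Prefix i v × (adj G (σ i) v ≡ true)
    in ∀ i → 0 Data.Nat.< toℕ i → IsModuleOf G (Prefix i) (Nbh i)
  where import Data.Nat

data CoTree : Set where
  leaf  : CoTree
  union : CoTree → CoTree → CoTree
  join  : CoTree → CoTree → CoTree

size : CoTree → ℕ
size leaf        = 1
size (union s t) = size s + size t
size (join s t)  = size s + size t

tadj : (t : CoTree) → Fin (size t) → Fin (size t) → Bool
tadj leaf _ _ = false
tadj (union s t) x y with splitAt (size s) x | splitAt (size s) y
... | inj₁ a | inj₁ b = tadj s a b
... | inj₂ a | inj₂ b = tadj t a b
... | _      | _      = false
tadj (join s t) x y with splitAt (size s) x | splitAt (size s) y
... | inj₁ a | inj₁ b = tadj s a b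
... | inj₂ a | inj₂ b = tadj t a b
... | _      | _      = true

toGraph : CoTree → Graph
toGraph t = record { n = size t ; adj = tadj t }

IsCograph : Graph → Set
IsCograph G = Σ CoTree λ t → toGraph t ≅ G

-- 2C₄: vertices 0..7, cycles 0-1-2-3-0 and 4-5-6-7-4.
twoC4-adj : Fin 8 → Fin 8 → Bool
twoC4-adj i j =
  let a = toℕ i ; b = toℕ j in
  (a / 4 ≡ᵇ b / 4) ∧ (((suc a) % 4 ≡ᵇ b % 4) ∨ ((suc b) % 4 ≡ᵇ a % 4))

co2C4 : Graph
co2C4 = record { n = 8 ; adj = λ i j → not (toℕ i ≡ᵇ toℕ j) ∧ not (twoC4-adj i j) }

ContainsInduced : Graph → Graph → Set
ContainsInduced G H =
  Σ (Fin (n H) → Fin (n G)) λ f → Injective _≡_ _≡_ f × (∀ x y → adj G (f x) (f y) ≡ adj H x y)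

module Submission where

-- (⇒) Let x be the vertex of an induced co-2C₄ placed last in the composition
-- order.  Every vertex x of co-2C₄ has neighbours p, o and a non-neighbour q that
-- tells p and o apart, so the neighbourhood of x in the prefix is not a module.
--
-- (⇐) Call a vertex order *modular* if each v's earlier neighbours are not told
-- apart by its earlier non-neighbours (this is module-composition), *dominating*
-- if each earlier neighbour of v sees every earlier non-neighbour of v.  Reading a
-- cotree as a sum graph on ⊤/⊎ and concatenating orders of the two parts: unions
-- keep modular orders (and dominating ones if the second part is edgeless), joins
-- of a modular with a dominating order are modular, of two dominating ones
-- dominating.  By induction every co-graph has a dominating order or contains 2K₂,
-- and a modular order or contains the join of two 2K₂, i.e. co-2C₄.

open import Defs
open import Relation.Nullary using (¬_)
open import Function.Bundles using (_⇔_)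

open import Data.Bool using (Bool; true; false)
open import Data.Bool.Properties using (¬-not) renaming (_≟_ to _≟ᵇ_)
open import Data.Empty using (⊥-elim)
open import Data.Fin as Fin using (Fin; toℕ; _↑ˡ_; _↑ʳ_)
open import Data.Fin.Properties
  using (all?; any?; toℕ-↑ˡ; toℕ-↑ʳ; toℕ<n; splitAt-join; +↔⊎; 1↔⊤; ≤∧≢⇒<)
  renaming (_≟_ to _≟ᶠ_)
open import Data.Fin.Permutation using (↔⇒≡)
open import Data.List using (allFin)
open import Data.List.Extrema.Nat using (argmax; f[xs]≤f[argmax])
open import Data.List.Membership.Propositional.Properties using (∈-allFin)
import Data.List.Relation.Unary.All as All
open import Data.Nat as ℕ using (ℕ; _+_; z≤n)
open import Data.Nat.Properties using (+-cancelˡ-<; <-asym; ≤-<-trans; m≤m+n; module ≤-Reasoning)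
open import Data.Product using (Σ; ∃; _×_; _,_; proj₁; proj₂)
open import Data.Sum as Sum using (_⊎_; inj₁; inj₂)
open import Data.Sum.Function.Propositional using (_⊎-↔_)
open import Data.Sum.Properties using (swap-↔)
open import Data.Unit using (⊤; tt)
open import Data.Vec using (_∷_; []; lookup)
open import Function.Bundles using (_↔_; Inverse; Injection; mk⇔)
open import Function.Construct.Composition using (_↔-∘_)
open import Function.Construct.Symmetry using (↔-sym)
open import Function.Definitions using (Injective)
open import Function.Properties.Inverse using (↔⇒↣)
open import Relation.Binary.PropositionalEquality
open import Relation.Nullary.Decidable using (from-yes; ¬?; _×-dec_; _⊎-dec_)

open Inverse using (to; from; strictlyInverseˡ; strictlyInverseʳ)

true≢false : ¬ (true ≡ false)
true≢false ()

Adj : Set → Set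
Adj V = V → V → Bool

-- The sum of two graphs with constant cross adjacency c:
-- c = false is the disjoint union, c = true is the join.
_⊕⟨_⟩_ : {X Y : Set} → Adj X → Bool → Adj Y → Adj (X ⊎ Y)
(A ⊕⟨ c ⟩ B) (inj₁ x) (inj₁ y) = A x y
(A ⊕⟨ c ⟩ B) (inj₂ x) (inj₂ y) = B x y
(A ⊕⟨ c ⟩ B) (inj₁ x) (inj₂ y) = c
(A ⊕⟨ c ⟩ B) (inj₂ x) (inj₁ y) = c

Edgeless : {V : Set} → Adj V → Set
Edgeless A = ∀ x y → A x y ≡ false

edgeless-union : {X Y : Set} {A : Adj X} {B : Adj Y} →
  Edgeless A → Edgeless B → Edgeless (A ⊕⟨ false ⟩ B)
edgeless-union eA eB (inj₁ x) (inj₁ y) = eA x y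
edgeless-union eA eB (inj₂ x) (inj₂ y) = eB x y
edgeless-union eA eB (inj₁ x) (inj₂ y) = refl
edgeless-union eA eB (inj₂ x) (inj₁ y) = refl

-- A copy of H in A: a map realising exactly the adjacencies of H.  It need not be
-- injective; for graphs whose vertices are told apart by their neighbourhoods it is.
record Copy {U V : Set} (H : Adj U) (A : Adj V) : Set where
  constructor copy
  field
    map   : U → V
    exact : ∀ x y → A (map x) (map y) ≡ H x y

_⊚_ : {U V W : Set} {H : Adj U} {A : Adj V} {B : Adj W} → Copy A B → Copy H A → Copy H B
copy g g-exact ⊚ copy f f-exact = copy (λ x → g (f x)) λ x y → trans (g-exact (f x) (f y)) (f-exact x y)

inj₁-copy : {X Y : Set} {A : Adj X} {B : Adj Y} {c : Bool} → Copy A (A ⊕⟨ c ⟩ B)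
inj₁-copy = copy inj₁ λ _ _ → refl

inj₂-copy : {X Y : Set} {A : Adj X} {B : Adj Y} {c : Bool} → Copy B (A ⊕⟨ c ⟩ B)
inj₂-copy = copy inj₂ λ _ _ → refl

_⊕-copy_ : {U U′ X Y : Set} {H : Adj U} {H′ : Adj U′} {A : Adj X} {B : Adj Y} {c : Bool} →
  Copy H A → Copy H′ B → Copy (H ⊕⟨ c ⟩ H′) (A ⊕⟨ c ⟩ B)
_⊕-copy_ {H = H} {H′} {A} {B} {c} (copy f f-exact) (copy g g-exact) = copy (Sum.map f g) exact
  where
  exact : ∀ x y → (A ⊕⟨ c ⟩ B) (Sum.map f g x) (Sum.map f g y) ≡ (H ⊕⟨ c ⟩ H′) x y
  exact (inj₁ x) (inj₁ y) = f-exact x y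
  exact (inj₂ x) (inj₂ y) = g-exact x y
  exact (inj₁ x) (inj₂ y) = refl
  exact (inj₂ x) (inj₁ y) = refl

Distinguishing : {U : Set} → Adj U → Set
Distinguishing {U} H = ∀ x y → x ≡ y ⊎ ∃ λ z → ¬ (H x z ≡ H y z)

copy-injective : {U V : Set} {H : Adj U} {A : Adj V} → Distinguishing H →
  (c : Copy H A) → Injective _≡_ _≡_ (Copy.map c)
copy-injective {H = H} {A} distinct (copy f f-exact) {x} {y} fx≡fy with distinct x y
... | inj₁ x≡y = x≡y
... | inj₂ (z , differ) = ⊥-elim (differ (begin
  H x z         ≡⟨ sym (f-exact x z) ⟩
  A (f x) (f z) ≡⟨ cong (λ u → A u (f z)) fx≡fy ⟩
  A (f y) (f z) ≡⟨ f-exact y z ⟩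
  H y z         ∎))
  where open ≡-Reasoning

copy⇒induced : (G H : Graph) → Distinguishing (adj H) → Copy (adj H) (adj G) → ContainsInduced G H
copy⇒induced G H distinct c = Copy.map c , copy-injective distinct c , Copy.exact c

record _≃_ {V W : Set} (A : Adj V) (B : Adj W) : Set where
  field
    bij       : V ↔ W
    preserves : ∀ x y → B (to bij x) (to bij y) ≡ A x y

  reflects : ∀ x y → B x y ≡ A (from bij x) (from bij y)
  reflects x y =
    trans (cong₂ B (sym (strictlyInverseˡ bij x)) (sym (strictlyInverseˡ bij y))) (preserves _ _)

open _≃_

≃-copy : {V W : Set} {A : Adj V} {B : Adj W} → A ≃ B → Copy A B
≃-copy e = copy (to (bij e)) (preserves e)

≃-trans : {U V W : Set} {A : Adj U} {B : Adj V} {C : Adj W} → A ≃ B → B ≃ C → A ≃ C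
≃-trans e e′ = record
  { bij       = bij e′ ↔-∘ bij e
  ; preserves = λ x y → trans (preserves e′ _ _) (preserves e x y) }

_⊕-≃_ : {X X′ Y Y′ : Set} {A : Adj X} {A′ : Adj X′} {B : Adj Y} {B′ : Adj Y′} {c : Bool} →
  A ≃ A′ → B ≃ B′ → (A ⊕⟨ c ⟩ B) ≃ (A′ ⊕⟨ c ⟩ B′)
_⊕-≃_ {A = A} {A′} {B} {B′} {c} e e′ = record { bij = bij e ⊎-↔ bij e′ ; preserves = sum-preserves }
  where
  sum-preserves : ∀ x y → (A′ ⊕⟨ c ⟩ B′) (to (bij e ⊎-↔ bij e′) x) (to (bij e ⊎-↔ bij e′) y) ≡ (A ⊕⟨ c ⟩ B) x y
  sum-preserves (inj₁ x) (inj₁ y) = preserves e x y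
  sum-preserves (inj₂ x) (inj₂ y) = preserves e′ x y
  sum-preserves (inj₁ x) (inj₂ y) = refl
  sum-preserves (inj₂ x) (inj₁ y) = refl

⊕-swap : {X Y : Set} {A : Adj X} {B : Adj Y} {c : Bool} → (A ⊕⟨ c ⟩ B) ≃ (B ⊕⟨ c ⟩ A)
⊕-swap {A = A} {B} {c} = record { bij = swap-↔ ; preserves = swap-preserves }
  where
  swap-preserves : ∀ x y → (B ⊕⟨ c ⟩ A) (Sum.swap x) (Sum.swap y) ≡ (A ⊕⟨ c ⟩ B) x y
  swap-preserves (inj₁ x) (inj₁ y) = refl
  swap-preserves (inj₂ x) (inj₂ y) = refl
  swap-preserves (inj₁ x) (inj₂ y) = refl
  swap-preserves (inj₂ x) (inj₁ y) = refl

-- Linear orders of a vertex type V are bijections V ↔ Fin k; a ≺⟨ φ ⟩ v says that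
-- a comes before v (a record, so that a and v can be inferred from it).
record _≺⟨_⟩_ {V : Set} {k : ℕ} (a : V) (φ : V ↔ Fin k) (v : V) : Set where
  constructor before
  field rank< : to φ a Fin.< to φ v

-- The earlier neighbours of v are not distinguished by its earlier non-neighbours,
-- i.e. the neighbourhood of v in the prefix before v is a module of that prefix.
ModularAt : {V : Set} {k : ℕ} → Adj V → V ↔ Fin k → V → Set
ModularAt A φ v = ∀ {a b w} → a ≺⟨ φ ⟩ v → b ≺⟨ φ ⟩ v → w ≺⟨ φ ⟩ v →
  A v a ≡ true → A v b ≡ true → A v w ≡ false → A a w ≡ A b w

DominatingAt : {V : Set} {k : ℕ} → Adj V → V ↔ Fin k → V → Set
DominatingAt A φ v = ∀ {a w} → a ≺⟨ φ ⟩ v → w ≺⟨ φ ⟩ v →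
  A v a ≡ true → A v w ≡ false → A a w ≡ true

ModularOrder DominatingOrder : {V : Set} {k : ℕ} → Adj V → V ↔ Fin k → Set
ModularOrder A φ = ∀ v → ModularAt A φ v
DominatingOrder A φ = ∀ v → DominatingAt A φ v

dominating⇒modular : {V : Set} {k : ℕ} {A : Adj V} {φ : V ↔ Fin k} {v : V} →
  DominatingAt A φ v → ModularAt A φ v
dominating⇒modular d a≺v b≺v w≺v va vb vw = trans (d a≺v w≺v va vw) (sym (d b≺v w≺v vb vw))

Ordered : {V : Set} → ({k : ℕ} → Adj V → V ↔ Fin k → Set) → Adj V → Set
Ordered {V} P A = Σ ℕ λ k → Σ (V ↔ Fin k) λ φ → P A φ

module Transport {V W : Set} {A : Adj V} {B : Adj W} (e : A ≃ B) where

  transported : {k : ℕ} → V ↔ Fin k → W ↔ Fin k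
  transported φ = φ ↔-∘ ↔-sym (bij e)

  private
    pull : ∀ {k} {φ : V ↔ Fin k} {a v} → a ≺⟨ transported φ ⟩ v → from (bij e) a ≺⟨ φ ⟩ from (bij e) v
    pull (before a<v) = before a<v

    readback : ∀ {x y β} → B x y ≡ β → A (from (bij e) x) (from (bij e) y) ≡ β
    readback = trans (sym (reflects e _ _))

  modular : {k : ℕ} {φ : V ↔ Fin k} → ModularOrder A φ → ModularOrder B (transported φ)
  modular m v {a} {b} {w} a≺v b≺v w≺v va vb vw = begin
    B a w                           ≡⟨ reflects e a w ⟩
    A (from (bij e) a) (from (bij e) w)
      ≡⟨ m (from (bij e) v) (pull a≺v) (pull b≺v) (pull w≺v) (readback va) (readback vb) (readback vw) ⟩
    A (from (bij e) b) (from (bij e) w) ≡⟨ sym (reflects e b w) ⟩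
    B b w                           ∎
    where open ≡-Reasoning

  dominating : {k : ℕ} {φ : V ↔ Fin k} → DominatingOrder A φ → DominatingOrder B (transported φ)
  dominating d v {a} {w} a≺v w≺v va vw =
    trans (reflects e a w) (d (from (bij e) v) (pull a≺v) (pull w≺v) (readback va) (readback vw))

  modularly-ordered : Ordered ModularOrder A → Ordered ModularOrder B
  modularly-ordered (k , φ , m) = k , transported φ , modular m

  dominatingly-ordered : Ordered DominatingOrder A → Ordered DominatingOrder B
  dominatingly-ordered (k , φ , d) = k , transported φ , dominating d

_++_ : {X Y : Set} {k l : ℕ} → X ↔ Fin k → Y ↔ Fin l → (X ⊎ Y) ↔ Fin (k + l)
φ ++ ψ = ↔-sym +↔⊎ ↔-∘ (φ ⊎-↔ ψ)

module Concatenation {X Y : Set} {k l : ℕ} (φ : X ↔ Fin k) (ψ : Y ↔ Fin l) where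

  ≺-inj₁ : ∀ {a v} → inj₁ a ≺⟨ φ ++ ψ ⟩ inj₁ v → a ≺⟨ φ ⟩ v
  ≺-inj₁ {a} {v} (before a<v) = before (subst₂ ℕ._<_ (toℕ-↑ˡ (to φ a) l) (toℕ-↑ˡ (to φ v) l) a<v)

  ≺-inj₂ : ∀ {a v} → inj₂ a ≺⟨ φ ++ ψ ⟩ inj₂ v → a ≺⟨ ψ ⟩ v
  ≺-inj₂ {a} {v} (before a<v) =
    before (+-cancelˡ-< k _ _ (subst₂ ℕ._<_ (toℕ-↑ʳ k (to ψ a)) (toℕ-↑ʳ k (to ψ v)) a<v))

  inj₁≺inj₂ : ∀ {a b} → inj₁ a ≺⟨ φ ++ ψ ⟩ inj₂ b
  inj₁≺inj₂ {a} {b} = before (begin-strict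
    toℕ (to φ a ↑ˡ l) ≡⟨ toℕ-↑ˡ (to φ a) l ⟩
    toℕ (to φ a)      <⟨ toℕ<n (to φ a) ⟩
    k                 ≤⟨ m≤m+n k (toℕ (to ψ b)) ⟩
    k + toℕ (to ψ b)  ≡⟨ toℕ-↑ʳ k (to ψ b) ⟨
    toℕ (k ↑ʳ to ψ b) ∎)
    where open ≤-Reasoning

  data EarlierInX (v : X) : X ⊎ Y → Set where
    earlier : ∀ {a} → a ≺⟨ φ ⟩ v → EarlierInX v (inj₁ a)

  earlier-in-X : ∀ {x v} → x ≺⟨ φ ++ ψ ⟩ inj₁ v → EarlierInX v x
  earlier-in-X {inj₁ a} a≺v = earlier (≺-inj₁ a≺v)
  earlier-in-X {inj₂ b} (before b<v) = ⊥-elim (<-asym b<v (_≺⟨_⟩_.rank< inj₁≺inj₂))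

  module _ {A : Adj X} {B : Adj Y} where

    modular-left : ∀ {c v} → ModularAt A φ v → ModularAt (A ⊕⟨ c ⟩ B) (φ ++ ψ) (inj₁ v)
    -- X is an initial segment, so a vertex of X only sees the order restricted to X.
    modular-left m a≺v b≺v w≺v with earlier-in-X a≺v | earlier-in-X b≺v | earlier-in-X w≺v
    ... | earlier a≺v′ | earlier b≺v′ | earlier w≺v′ = m a≺v′ b≺v′ w≺v′

    dominating-left : ∀ {c v} → DominatingAt A φ v → DominatingAt (A ⊕⟨ c ⟩ B) (φ ++ ψ) (inj₁ v)
    dominating-left d a≺v w≺v with earlier-in-X a≺v | earlier-in-X w≺v
    ... | earlier a≺v′ | earlier w≺v′ = d a≺v′ w≺v′

    -- In a union, a vertex of Y has only neighbours in Y, and all of X looks alike to them.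
    union-modular-right : ∀ {v} → ModularAt B ψ v → ModularAt (A ⊕⟨ false ⟩ B) (φ ++ ψ) (inj₂ v)
    union-modular-right m {inj₂ a} {inj₂ b} {inj₁ w} _ _ _ _ _ _ = refl
    union-modular-right m {inj₂ a} {inj₂ b} {inj₂ w} a≺v b≺v w≺v =
      m (≺-inj₂ a≺v) (≺-inj₂ b≺v) (≺-inj₂ w≺v)
    union-modular-right m {inj₁ a} _ _ _ ()
    union-modular-right m {inj₂ a} {inj₁ b} _ _ _ _ ()

    -- In a join, the non-neighbours of a vertex of Y lie in Y, and all of X sees them.
    join-dominating-right : ∀ {v} → DominatingAt B ψ v → DominatingAt (A ⊕⟨ true ⟩ B) (φ ++ ψ) (inj₂ v)
    join-dominating-right d {inj₁ a} {inj₂ w} _ _ _ _ = refl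
    join-dominating-right d {inj₂ a} {inj₂ w} a≺v w≺v = d (≺-inj₂ a≺v) (≺-inj₂ w≺v)
    join-dominating-right d {_} {inj₁ w} _ _ _ ()

    modular-union : ModularOrder A φ → ModularOrder B ψ → ModularOrder (A ⊕⟨ false ⟩ B) (φ ++ ψ)
    modular-union mA mB (inj₁ v) = modular-left (mA v)
    modular-union mA mB (inj₂ v) = union-modular-right (mB v)

    modular-join : ModularOrder A φ → DominatingOrder B ψ → ModularOrder (A ⊕⟨ true ⟩ B) (φ ++ ψ)
    modular-join mA dB (inj₁ v) = modular-left (mA v)
    modular-join mA dB (inj₂ v) = dominating⇒modular (join-dominating-right (dB v))

    -- An edgeless graph placed last: its vertices have no neighbours at all.
    dominating-union : DominatingOrder A φ → Edgeless B → DominatingOrder (A ⊕⟨ false ⟩ B) (φ ++ ψ)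
    dominating-union dA eB (inj₁ v) = dominating-left (dA v)
    dominating-union dA eB (inj₂ v) {inj₂ a} _ _ va _ = ⊥-elim (true≢false (trans (sym va) (eB v a)))
    dominating-union dA eB (inj₂ v) {inj₁ a} _ _ ()

    dominating-join : DominatingOrder A φ → DominatingOrder B ψ → DominatingOrder (A ⊕⟨ true ⟩ B) (φ ++ ψ)
    dominating-join dA dB (inj₁ v) = dominating-left (dA v)
    dominating-join dA dB (inj₂ v) = join-dominating-right (dB v)

open Concatenation using (modular-union; modular-join; dominating-union; dominating-join)

K₁ : Adj ⊤
K₁ _ _ = false

K₂ : Adj (⊤ ⊎ ⊤)
K₂ = K₁ ⊕⟨ true ⟩ K₁

2K₂ : Adj ((⊤ ⊎ ⊤) ⊎ (⊤ ⊎ ⊤))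
2K₂ = K₂ ⊕⟨ false ⟩ K₂

2K₂-join-2K₂ : Adj (((⊤ ⊎ ⊤) ⊎ (⊤ ⊎ ⊤)) ⊎ ((⊤ ⊎ ⊤) ⊎ (⊤ ⊎ ⊤)))
2K₂-join-2K₂ = 2K₂ ⊕⟨ true ⟩ 2K₂

-- co-2C₄ is the join of two 2K₂: in each 4-cycle 0-1-2-3 the complement edges are
-- the diagonals {0,2} and {1,3}.
co2C4-as-join : Copy (adj co2C4) 2K₂-join-2K₂
co2C4-as-join =
  copy place (from-yes (all? λ x → all? λ y → 2K₂-join-2K₂ (place x) (place y) ≟ᵇ adj co2C4 x y))
  where
  a b c d : (⊤ ⊎ ⊤) ⊎ (⊤ ⊎ ⊤)
  a = inj₁ (inj₁ tt)
  b = inj₁ (inj₂ tt)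
  c = inj₂ (inj₁ tt)
  d = inj₂ (inj₂ tt)
  place : Fin 8 → ((⊤ ⊎ ⊤) ⊎ (⊤ ⊎ ⊤)) ⊎ ((⊤ ⊎ ⊤) ⊎ (⊤ ⊎ ⊤))
  place = lookup (inj₁ a ∷ inj₁ c ∷ inj₁ b ∷ inj₁ d ∷ inj₂ a ∷ inj₂ c ∷ inj₂ b ∷ inj₂ d ∷ [])

co2C4-distinguishing : Distinguishing (adj co2C4)
co2C4-distinguishing =
  from-yes (all? λ x → all? λ y → (x ≟ᶠ y) ⊎-dec any? λ z → ¬? (adj co2C4 x z ≟ᵇ adj co2C4 y z))

NonModularNeighbourhood : {V : Set} → Adj V → V → Set
NonModularNeighbourhood {V} H x = Σ V λ p → Σ V λ o → Σ V λ q →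
  H x p ≡ true × H x o ≡ true × H x q ≡ false ×
  ¬ (p ≡ x) × ¬ (o ≡ x) × ¬ (q ≡ x) × ¬ (H p q ≡ H o q)

co2C4-nonmodular : ∀ x → NonModularNeighbourhood (adj co2C4) x
co2C4-nonmodular = from-yes (all? λ x → any? λ p → any? λ o → any? λ q →
  (H x p ≟ᵇ true) ×-dec (H x o ≟ᵇ true) ×-dec (H x q ≟ᵇ false) ×-dec
  ¬? (p ≟ᶠ x) ×-dec ¬? (o ≟ᶠ x) ×-dec ¬? (q ≟ᶠ x) ×-dec ¬? (H p q ≟ᵇ H o q))
  where
  H : Adj (Fin 8)
  H = adj co2C4

Vertex : CoTree → Set
Vertex leaf        = ⊤
Vertex (union s t) = Vertex s ⊎ Vertex t
Vertex (join s t)  = Vertex s ⊎ Vertex t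

⟦_⟧ : (t : CoTree) → Adj (Vertex t)
⟦ leaf ⟧      = K₁
⟦ union s t ⟧ = ⟦ s ⟧ ⊕⟨ false ⟩ ⟦ t ⟧
⟦ join s t ⟧  = ⟦ s ⟧ ⊕⟨ true ⟩ ⟦ t ⟧

union-is-sum : ∀ s t → (tadj s ⊕⟨ false ⟩ tadj t) ≃ tadj (union s t)
union-is-sum s t = record { bij = ↔-sym +↔⊎ ; preserves = agree }
  where
  agree : ∀ x y → tadj (union s t) (Fin.join _ _ x) (Fin.join _ _ y) ≡ (tadj s ⊕⟨ false ⟩ tadj t) x y
  agree x y rewrite splitAt-join (size s) (size t) x | splitAt-join (size s) (size t) y with x | y
  ... | inj₁ _ | inj₁ _ = refl
  ... | inj₁ _ | inj₂ _ = refl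
  ... | inj₂ _ | inj₁ _ = refl
  ... | inj₂ _ | inj₂ _ = refl

join-is-sum : ∀ s t → (tadj s ⊕⟨ true ⟩ tadj t) ≃ tadj (join s t)
join-is-sum s t = record { bij = ↔-sym +↔⊎ ; preserves = agree }
  where
  agree : ∀ x y → tadj (join s t) (Fin.join _ _ x) (Fin.join _ _ y) ≡ (tadj s ⊕⟨ true ⟩ tadj t) x y
  agree x y rewrite splitAt-join (size s) (size t) x | splitAt-join (size s) (size t) y with x | y
  ... | inj₁ _ | inj₁ _ = refl
  ... | inj₁ _ | inj₂ _ = refl
  ... | inj₂ _ | inj₁ _ = refl
  ... | inj₂ _ | inj₂ _ = refl

⟦⟧≃tadj : ∀ t → ⟦ t ⟧ ≃ tadj t
⟦⟧≃tadj leaf        = record { bij = ↔-sym 1↔⊤ ; preserves = λ _ _ → refl }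
⟦⟧≃tadj (union s t) = ≃-trans (⟦⟧≃tadj s ⊕-≃ ⟦⟧≃tadj t) (union-is-sum s t)
⟦⟧≃tadj (join s t)  = ≃-trans (⟦⟧≃tadj s ⊕-≃ ⟦⟧≃tadj t) (join-is-sum s t)

cograph-sum-form : (G : Graph) → IsCograph G → Σ CoTree λ t → ⟦ t ⟧ ≃ adj G
cograph-sum-form G (t , t≅G) =
  t , ≃-trans (⟦⟧≃tadj t) (record { bij = _≅_.bij t≅G ; preserves = _≅_.preserve t≅G })

vertex : ∀ t → Copy K₁ ⟦ t ⟧
vertex leaf        = copy (λ _ → tt) λ _ _ → refl
vertex (union s t) = inj₁-copy ⊚ vertex s
vertex (join s t)  = inj₁-copy ⊚ vertex s

edgeless-or-K₂ : ∀ t → Edgeless ⟦ t ⟧ ⊎ Copy K₂ ⟦ t ⟧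
edgeless-or-K₂ leaf = inj₁ λ _ _ → refl
edgeless-or-K₂ (union s t) with edgeless-or-K₂ s | edgeless-or-K₂ t
... | inj₁ es | inj₁ et = inj₁ (edgeless-union es et)
... | inj₂ e  | _       = inj₂ (inj₁-copy ⊚ e)
... | inj₁ _  | inj₂ e  = inj₂ (inj₂-copy ⊚ e)
edgeless-or-K₂ (join s t) = inj₂ (vertex s ⊕-copy vertex t)

leaf-order : ⊤ ↔ Fin 1
leaf-order = ↔-sym 1↔⊤

-- A 2K₂-free co-graph has a dominating order.  In a union of two such parts one of
-- them is edgeless (otherwise their edges form a 2K₂) and is placed last.
dominating-or-2K₂ : ∀ t → Ordered DominatingOrder ⟦ t ⟧ ⊎ Copy 2K₂ ⟦ t ⟧
dominating-or-2K₂ leaf = inj₁ (1 , leaf-order , λ _ _ _ ())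
dominating-or-2K₂ (union s t) with dominating-or-2K₂ s | dominating-or-2K₂ t
... | inj₂ c | _      = inj₂ (inj₁-copy ⊚ c)
... | inj₁ _ | inj₂ c = inj₂ (inj₂-copy ⊚ c)
... | inj₁ (_ , φ , dφ) | inj₁ (_ , ψ , dψ) with edgeless-or-K₂ s | edgeless-or-K₂ t
...   | _       | inj₁ et = inj₁ (_ , φ ++ ψ , dominating-union φ ψ dφ et)
...   | inj₁ es | inj₂ _  =
        inj₁ (Transport.dominatingly-ordered ⊕-swap (_ , ψ ++ φ , dominating-union ψ φ dψ es))
...   | inj₂ es | inj₂ et = inj₂ (es ⊕-copy et)
dominating-or-2K₂ (join s t) with dominating-or-2K₂ s | dominating-or-2K₂ t
... | inj₂ c | _      = inj₂ (inj₁-copy ⊚ c)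
... | inj₁ _ | inj₂ c = inj₂ (inj₂-copy ⊚ c)
... | inj₁ (_ , φ , dφ) | inj₁ (_ , ψ , dψ) = inj₁ (_ , φ ++ ψ , dominating-join φ ψ dφ dψ)

-- A co-graph without a copy of the join of two 2K₂ has a modular order.  In a join,
-- one part is 2K₂-free; it gets a dominating order and is placed last.
modular-or-2K₂-join-2K₂ : ∀ t → Ordered ModularOrder ⟦ t ⟧ ⊎ Copy 2K₂-join-2K₂ ⟦ t ⟧
modular-or-2K₂-join-2K₂ leaf = inj₁ (1 , leaf-order , λ _ _ _ _ ())
modular-or-2K₂-join-2K₂ (union s t) with modular-or-2K₂-join-2K₂ s | modular-or-2K₂-join-2K₂ t
... | inj₂ c | _      = inj₂ (inj₁-copy ⊚ c)
... | inj₁ _ | inj₂ c = inj₂ (inj₂-copy ⊚ c)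
... | inj₁ (_ , φ , mφ) | inj₁ (_ , ψ , mψ) = inj₁ (_ , φ ++ ψ , modular-union φ ψ mφ mψ)
modular-or-2K₂-join-2K₂ (join s t) with modular-or-2K₂-join-2K₂ s | modular-or-2K₂-join-2K₂ t
... | inj₂ c | _      = inj₂ (inj₁-copy ⊚ c)
... | inj₁ _ | inj₂ c = inj₂ (inj₂-copy ⊚ c)
... | inj₁ (_ , φ , mφ) | inj₁ (_ , ψ , mψ) with dominating-or-2K₂ s | dominating-or-2K₂ t
...   | _                   | inj₁ (_ , ψ′ , dψ′) = inj₁ (_ , φ ++ ψ′ , modular-join φ ψ′ mφ dψ′)
...   | inj₁ (_ , φ′ , dφ′) | inj₂ _              =
        inj₁ (Transport.modularly-ordered ⊕-swap (_ , ψ ++ φ′ , modular-join ψ φ′ mψ dφ′))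
...   | inj₂ cs             | inj₂ ct             = inj₂ (cs ⊕-copy ct)

modular⇒module-composed : (G : Graph) → Ordered ModularOrder (adj G) → ModuleComposed G
modular⇒module-composed G (k , φ , modular) with ↔⇒≡ φ
... | refl = φ , λ i _ → (λ _ → proj₁) , neighbourhood-module i
  where
  Prefix Neighbours : Fin (n G) → Fin (n G) → Set
  Prefix i v = Σ (Fin (n G)) λ j → (j Fin.< i) × (from φ j ≡ v)
  Neighbours i v = Prefix i v × (adj G (from φ i) v ≡ true)

  in-prefix : ∀ {i v} → Prefix i v → v ≺⟨ φ ⟩ from φ i
  in-prefix {i} (j , j<i , refl) = before
    (subst₂ Fin._<_ (sym (strictlyInverseˡ φ j)) (sym (strictlyInverseˡ φ i)) j<i)

  neighbourhood-module : ∀ i v₁ v₂ w → Neighbours i v₁ → Neighbours i v₂ → Prefix i w →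
    ¬ Neighbours i w → adj G v₁ w ≡ adj G v₂ w
  neighbourhood-module i v₁ v₂ w (v₁∈U , iv₁) (v₂∈U , iv₂) w∈U w∉N =
    modular (from φ i) (in-prefix v₁∈U) (in-prefix v₂∈U) (in-prefix w∈U) iv₁ iv₂
      (¬-not λ iw → w∉N (w∈U , iw))

-- In a module-composed graph, the last vertex of an induced copy of H has a modular
-- neighbourhood in H; so H cannot be induced if no vertex of H has one.
module-composed-excludes : (G H : Graph) → ModuleComposed G → Fin (n H) →
  (∀ x → NonModularNeighbourhood (adj H) x) → ¬ ContainsInduced G H
module-composed-excludes G H (φ , composed) x₀ nonmodular (f , f-inj , f-pres) =
  refute (nonmodular x)
  where
  rank : Fin (n H) → ℕ
  rank y = toℕ (to φ (f y))

  -- the vertex of the copy placed last, at position i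
  x : Fin (n H)
  x = argmax rank x₀ (allFin (n H))

  i : Fin (n G)
  i = to φ (f x)

  before-x : ∀ {y} → ¬ (y ≡ x) → Σ (Fin (n G)) λ j → (j Fin.< i) × (from φ j ≡ f y)
  before-x {y} y≢x = to φ (f y) , ≤∧≢⇒< maximal distinct , strictlyInverseʳ φ (f y)
    where
    maximal : rank y ℕ.≤ rank x
    maximal = All.lookup (f[xs]≤f[argmax] x₀ (allFin (n H))) (∈-allFin y)
    distinct : ¬ (to φ (f y) ≡ i)
    distinct e = y≢x (f-inj (Injection.injective (↔⇒↣ φ) e))

  adj-x : ∀ y → adj G (from φ i) (f y) ≡ adj H x y
  adj-x y = trans (cong (λ u → adj G u (f y)) (strictlyInverseʳ φ (f x))) (f-pres x y)

  refute : ¬ NonModularNeighbourhood (adj H) x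
  refute (p , o , q , xp , xo , xq , p≢x , o≢x , q≢x , pq≢oq) = pq≢oq (begin
    adj H p q         ≡⟨ sym (f-pres p q) ⟩
    adj G (f p) (f q) ≡⟨ q-sees-p-and-o-alike ⟩
    adj G (f o) (f q) ≡⟨ f-pres o q ⟩
    adj H o q         ∎)
    where
    open ≡-Reasoning
    -- x is not first, since p comes before it
    i-positive : 0 ℕ.< toℕ i
    i-positive = ≤-<-trans z≤n (proj₁ (proj₂ (before-x p≢x)))
    q-sees-p-and-o-alike : adj G (f p) (f q) ≡ adj G (f o) (f q)
    q-sees-p-and-o-alike = proj₂ (composed i i-positive) (f p) (f o) (f q)
      (before-x p≢x , trans (adj-x p) xp) (before-x o≢x , trans (adj-x o) xo) (before-x q≢x)
      (λ (_ , xq′) → true≢false (trans (sym xq′) (trans (adj-x q) xq)))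

lemma4 : (G : Graph) → IsSimple G → IsCograph G →
    (ModuleComposed G ⇔ (¬ ContainsInduced G co2C4))
lemma4 G _ cograph = mk⇔ excludes composed
  where
  excludes : ModuleComposed G → ¬ ContainsInduced G co2C4
  excludes mc = module-composed-excludes G co2C4 mc Fin.zero co2C4-nonmodular

  composed : ¬ ContainsInduced G co2C4 → ModuleComposed G
  composed free with cograph-sum-form G cograph
  ... | t , t≃G with modular-or-2K₂-join-2K₂ t
  ...   | inj₁ ordered = modular⇒module-composed G (Transport.modularly-ordered t≃G ordered)
  ...   | inj₂ c       = ⊥-elim (free (copy⇒induced G co2C4 co2C4-distinguishing
                                         ((≃-copy t≃G ⊚ c) ⊚ co2C4-as-join)))
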